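{- Let $G_1, G_2$ be finite groups and $\pi : G_1 \to G_2$ a surjective homomorphism. Let $H_1 \subseteq G_1$, $H_2 \subseteq G_2$ be subgroups with $\pi(H_1) = H_2$, and let $N_1 \unlhd G_1$, $N_2 \unlhd G_2$ be normal subgroups with $\pi(N_1) = N_2$. Assume $\gcd(\#N_1, \#\ker\pi) = 1$ and $[N_1, \ker \pi] = \{1\}$. Then $N_1 \subseteq H_1$ if and only if $N_2 \subseteq H_2$. -}

module Defs where

open import Level using (0ℓ)
open import Data.Nat using (ℕ)
open import Data.Fin using (Fin)
open import Data.Fin.Properties using (_≟_)
open import Data.Fin.Subset using (Subset; _∈_)
open import Data.Vec using (tabulate)
open import Data.Product using (Σ-syntax; _×_)
open import Relation.Nullary using (does)
open import Relation.Binary.PropositionalEquality using (_≡_)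
open import Algebra.Bundles.Raw using (RawGroup)
open import Algebra.Structures using (IsGroup)
open import Algebra.Morphism.Structures using (IsGroupHomomorphism)

-- A finite group: carrier Fin order (every finite group is isomorphic to
-- one of this form), with propositional equality.
record FinGroup : Set where
  infixl 7 _∙_
  field
    order   : ℕ
    _∙_     : Fin order → Fin order → Fin order
    ε       : Fin order
    _⁻¹     : Fin order → Fin order
    isGroup : IsGroup _≡_ _∙_ ε _⁻¹

  Elt : Set
  Elt = Fin order

  rawGroup : RawGroup 0ℓ 0ℓ
  rawGroup = record { Carrier = Fin order ; _≈_ = _≡_ ; _∙_ = _∙_ ; ε = ε ; _⁻¹ = _⁻¹ }

  [_,_] : Elt → Elt → Elt
  [ x , y ] = x ⁻¹ ∙ y ⁻¹ ∙ x ∙ y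

  record IsSubgroup (H : Subset order) : Set where
    field
      ε-mem   : ε ∈ H
      ∙-mem   : ∀ {x y} → x ∈ H → y ∈ H → x ∙ y ∈ H
      ⁻¹-mem  : ∀ {x} → x ∈ H → x ⁻¹ ∈ H

  record IsNormalSubgroup (N : Subset order) : Set where
    field
      isSubgroup : IsSubgroup N
      conj-mem   : ∀ g {x} → x ∈ N → g ∙ x ∙ g ⁻¹ ∈ N

open FinGroup public using (Elt; IsSubgroup; IsNormalSubgroup)

IsHom : (G₁ G₂ : FinGroup) → (Elt G₁ → Elt G₂) → Set
IsHom G₁ G₂ π = IsGroupHomomorphism (FinGroup.rawGroup G₁) (FinGroup.rawGroup G₂) π

Surjective : {A B : Set} → (A → B) → Set
Surjective {A} {B} f = ∀ (y : B) → Σ[ x ∈ A ] f x ≡ y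

ker : (G₁ G₂ : FinGroup) → (Elt G₁ → Elt G₂) → Subset (FinGroup.order G₁)
ker G₁ G₂ π = tabulate (λ x → does (π x ≟ FinGroup.ε G₂))

ImageIs : (G₁ G₂ : FinGroup) → (Elt G₁ → Elt G₂) →
          Subset (FinGroup.order G₁) → Subset (FinGroup.order G₂) → Set
ImageIs G₁ G₂ π H₁ H₂ =
  (∀ x → x ∈ H₁ → π x ∈ H₂) × (∀ y → y ∈ H₂ → Σ[ x ∈ Elt G₁ ] (x ∈ H₁ × π x ≡ y))

{-# OPTIONS --safe #-}
-- Only N₂ ⊆ H₂ ⇒ N₁ ⊆ H₁ needs work. For n ∈ N₁, π n ∈ N₂ ⊆ H₂ = π H₁ gives
-- h ∈ H₁ with h = n k and k ∈ ker π. The commutator hypothesis makes n and k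
-- commute, so h ^ ∣ker π∣ = n ^ ∣ker π∣, which therefore lies in H₁. Since also
-- n ^ ∣N₁∣ = 1 and the two exponents are coprime, n is a power of n ^ ∣ker π∣
-- and hence lies in H₁. Both exponent laws are instances of x ^ ∣T∣ = 1 for any
-- set T closed under left multiplication by x: such a T splits into ⟨x⟩-orbits
-- of size ord x.
module Submission where

open import Level using (0ℓ)
open import Data.Fin using (zero; suc; toℕ)
open import Data.Fin.Properties using (_≟_; pigeonhole)
open import Data.Fin.Subset
  using (Subset; inside; outside; _∈_; _∉_; _⊆_; ∣_∣; _∪_; _∩_; ∁; ⁅_⁆; ⊥)
open import Data.Fin.Subset.Properties
  using ( drop-∷-⊆; ∪-identityʳ; ∉⊥; ∣⊥∣≡0; x∈⁅x⁆; x∈⁅y⁆⇒x≡y; x∈p∪q⁺; x∈p∪q⁻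
        ; x∈p∩q⁺; x∈p∩q⁻; x∈∁p⇒x∉p; x∉p⇒x∈∁p; nonempty?; Empty-unique )
open import Data.Nat using (ℕ; zero; suc; _+_; _*_; _<_; _≤_; z<s; s<s; s≤s⁻¹; s<s⁻¹)
open import Data.Nat.Properties
  using (+-suc; ≤-refl; <⇒≤; n<1+n; m<n⇒m<1+n; m<1+n⇒m<n∨m≡n; m<m+n)
open import Data.Nat.GCD using (gcd; gcd-GCD; GCD; module Bézout)
open import Data.Nat.Induction using (<-wellFounded)
open import Data.Product using (_×_; _,_; ∃; proj₁; proj₂)
open import Data.Sum using (_⊎_; inj₁; inj₂; [_,_]′)
open import Data.Vec using ([]; _∷_; here; there)
open import Data.Vec.Properties using (lookup∘tabulate; lookup⇒[]=; []=⇒lookup)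
open import Function using (_∘_; id)
open import Induction.WellFounded using (Acc; acc)
open import Relation.Nullary using (¬_; Dec; yes; no; proof; contradiction)
open import Relation.Nullary.Decidable using (dec-true)
open import Relation.Nullary.Reflects using (Reflects; invert)
open import Relation.Binary.PropositionalEquality
  using (_≡_; _≢_; refl; sym; trans; cong; cong₂; subst; module ≡-Reasoning)
open import Algebra.Bundles using (Group)
open import Algebra.Structures using (IsGroup)
open import Algebra.Morphism.Structures using (module GroupMorphisms)
import Algebra.Properties.Group as GroupProperties
import Algebra.Properties.Monoid.Mult as MonoidMult
open import Defs

x∉p⇒∣p∪⁅x⁆∣≡1+∣p∣ : ∀ {n} (p : Subset n) {x} → x ∉ p → ∣ p ∪ ⁅ x ⁆ ∣ ≡ suc ∣ p ∣
x∉p⇒∣p∪⁅x⁆∣≡1+∣p∣ (inside  ∷ p) {zero}  x∉p = contradiction here x∉p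
x∉p⇒∣p∪⁅x⁆∣≡1+∣p∣ (outside ∷ p) {zero}  _   = cong (suc ∘ ∣_∣) (∪-identityʳ p)
x∉p⇒∣p∪⁅x⁆∣≡1+∣p∣ (inside  ∷ p) {suc x} x∉p = cong suc (x∉p⇒∣p∪⁅x⁆∣≡1+∣p∣ p (x∉p ∘ there))
x∉p⇒∣p∪⁅x⁆∣≡1+∣p∣ (outside ∷ p) {suc x} x∉p = x∉p⇒∣p∪⁅x⁆∣≡1+∣p∣ p (x∉p ∘ there)

q⊆p⇒∣p∣≡∣p∩∁q∣+∣q∣ : ∀ {n} (p q : Subset n) → q ⊆ p → ∣ p ∣ ≡ ∣ p ∩ ∁ q ∣ + ∣ q ∣
q⊆p⇒∣p∣≡∣p∩∁q∣+∣q∣ []            []            _   = refl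
q⊆p⇒∣p∣≡∣p∩∁q∣+∣q∣ (inside  ∷ p) (inside  ∷ q) q⊆p =
  trans (cong suc (q⊆p⇒∣p∣≡∣p∩∁q∣+∣q∣ p q (drop-∷-⊆ q⊆p))) (sym (+-suc _ _))
q⊆p⇒∣p∣≡∣p∩∁q∣+∣q∣ (inside  ∷ p) (outside ∷ q) q⊆p =
  cong suc (q⊆p⇒∣p∣≡∣p∩∁q∣+∣q∣ p q (drop-∷-⊆ q⊆p))
q⊆p⇒∣p∣≡∣p∩∁q∣+∣q∣ (outside ∷ p) (inside  ∷ q) q⊆p = contradiction (q⊆p here) λ ()
q⊆p⇒∣p∣≡∣p∩∁q∣+∣q∣ (outside ∷ p) (outside ∷ q) q⊆p =
  q⊆p⇒∣p∣≡∣p∩∁q∣+∣q∣ p q (drop-∷-⊆ q⊆p)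

Minimal : (ℕ → Set) → ℕ → Set
Minimal P m = P m × (∀ {j} → j < m → ¬ P j)

module _ {P : ℕ → Set} (P? : ∀ n → Dec (P n)) where

  minimal-or-none-below : ∀ n → ∃ (Minimal P) ⊎ (∀ {j} → j < n → ¬ P j)
  minimal-or-none-below zero = inj₂ λ ()
  minimal-or-none-below (suc n) with minimal-or-none-below n | P? n
  ... | inj₁ found | _      = inj₁ found
  ... | inj₂ none  | yes pn = inj₁ (n , pn , none)
  ... | inj₂ none  | no ¬pn = inj₂ λ j<1+n → [ none , (λ { refl → ¬pn }) ]′ (m<1+n⇒m<n∨m≡n j<1+n)

  minimal : ∀ n → P n → ∃ (Minimal P)
  minimal n pn =
    [ id , (λ none → contradiction pn (none (n<1+n n))) ]′ (minimal-or-none-below (suc n))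

module FinGroupProperties (G : FinGroup) where
  open FinGroup G hiding (Elt; IsSubgroup; IsNormalSubgroup)

  group : Group 0ℓ 0ℓ
  group = record
    { Carrier = Elt G ; _≈_ = _≡_ ; _∙_ = _∙_ ; ε = ε ; _⁻¹ = _⁻¹ ; isGroup = isGroup }

  open Group group using (assoc; identityˡ; identityʳ; monoid)
  open GroupProperties group using (∙-cancelˡ; ∙-cancelʳ; ⁻¹-anti-homo-∙; inverseˡ-unique; ⁻¹-injective)
  open MonoidMult monoid using (×-homo-+; ×-assocˡ) renaming (_×_ to _times_)
  open ≡-Reasoning

  infixr 8 _^_
  _^_ : Elt G → ℕ → Elt G
  x ^ n = n times x

  ^-homo-+ : ∀ x m n → x ^ (m + n) ≡ x ^ m ∙ x ^ n
  ^-homo-+ = ×-homo-+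

  ^-assoc : ∀ x m n → (x ^ n) ^ m ≡ x ^ (m * n)
  ^-assoc = ×-assocˡ

  ε^n≡ε : ∀ n → ε ^ n ≡ ε
  ε^n≡ε zero    = refl
  ε^n≡ε (suc n) = trans (cong (ε ∙_) (ε^n≡ε n)) (identityˡ ε)

  x^a≡ε⇒x^[k*a]≡ε : ∀ {x a} → x ^ a ≡ ε → ∀ k → x ^ (k * a) ≡ ε
  x^a≡ε⇒x^[k*a]≡ε {x} {a} x^a≡ε k =
    trans (sym (^-assoc x k a)) (trans (cong (_^ k) x^a≡ε) (ε^n≡ε k))

  [x,y]≡ε⇒x∙y≡y∙x : ∀ {x y} → [ x , y ] ≡ ε → x ∙ y ≡ y ∙ x
  [x,y]≡ε⇒x∙y≡y∙x {x} {y} [x,y]≡ε = sym (⁻¹-injective (inverseˡ-unique _ _ (begin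
    (y ∙ x) ⁻¹ ∙ (x ∙ y)   ≡⟨ cong (_∙ (x ∙ y)) (⁻¹-anti-homo-∙ y x) ⟩
    x ⁻¹ ∙ y ⁻¹ ∙ (x ∙ y)  ≡⟨ sym (assoc _ _ _) ⟩
    [ x , y ]              ≡⟨ [x,y]≡ε ⟩
    ε                      ∎)))

  x^n∙y≡y∙x^n : ∀ {x y} → x ∙ y ≡ y ∙ x → ∀ n → x ^ n ∙ y ≡ y ∙ x ^ n
  x^n∙y≡y∙x^n _ zero = trans (identityˡ _) (sym (identityʳ _))
  x^n∙y≡y∙x^n {x} {y} x∙y≡y∙x (suc n) = begin
    x ∙ x ^ n ∙ y    ≡⟨ assoc _ _ _ ⟩
    x ∙ (x ^ n ∙ y)  ≡⟨ cong (x ∙_) (x^n∙y≡y∙x^n x∙y≡y∙x n) ⟩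
    x ∙ (y ∙ x ^ n)  ≡⟨ sym (assoc _ _ _) ⟩
    x ∙ y ∙ x ^ n    ≡⟨ cong (_∙ x ^ n) x∙y≡y∙x ⟩
    y ∙ x ∙ x ^ n    ≡⟨ assoc _ _ _ ⟩
    y ∙ (x ∙ x ^ n)  ∎

  ^-distrib-∙ : ∀ {x y} → x ∙ y ≡ y ∙ x → ∀ n → (x ∙ y) ^ n ≡ x ^ n ∙ y ^ n
  ^-distrib-∙ _ zero = sym (identityˡ ε)
  ^-distrib-∙ {x} {y} x∙y≡y∙x (suc n) = begin
    x ∙ y ∙ (x ∙ y) ^ n        ≡⟨ cong (x ∙ y ∙_) (^-distrib-∙ x∙y≡y∙x n) ⟩
    x ∙ y ∙ (x ^ n ∙ y ^ n)    ≡⟨ assoc _ _ _ ⟩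
    x ∙ (y ∙ (x ^ n ∙ y ^ n))  ≡⟨ cong (x ∙_) (sym (assoc _ _ _)) ⟩
    x ∙ (y ∙ x ^ n ∙ y ^ n)    ≡⟨ cong (λ z → x ∙ (z ∙ y ^ n)) (sym (x^n∙y≡y∙x^n x∙y≡y∙x n)) ⟩
    x ∙ (x ^ n ∙ y ∙ y ^ n)    ≡⟨ cong (x ∙_) (assoc _ _ _) ⟩
    x ∙ (x ^ n ∙ (y ∙ y ^ n))  ≡⟨ sym (assoc _ _ _) ⟩
    x ∙ x ^ n ∙ (y ∙ y ^ n)    ∎

  x^i≡x^j⇒period : ∀ {x i j} → i < j → x ^ i ≡ x ^ j → ∃ λ k → x ^ suc k ≡ ε
  x^i≡x^j⇒period {j = suc k} z<s ε≡x^j = k , sym ε≡x^j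
  x^i≡x^j⇒period {x} {suc i} {suc j} (s<s i<j) x^i≡x^j =
    x^i≡x^j⇒period {x} {i} {j} i<j (∙-cancelˡ x _ _ x^i≡x^j)

  HasOrderSuc : Elt G → ℕ → Set
  HasOrderSuc x = Minimal (λ k → x ^ suc k ≡ ε)

  order-exists : ∀ x → ∃ (HasOrderSuc x)
  order-exists x with i , j , i<j , x^i≡x^j ← pigeonhole (n<1+n order) (λ i → x ^ toℕ i)
    = let k , x^[1+k]≡ε = x^i≡x^j⇒period {x} {toℕ i} {toℕ j} i<j x^i≡x^j
      in minimal (λ k → x ^ suc k ≟ ε) k x^[1+k]≡ε

  ^-injective-below-order : ∀ {x m} → HasOrderSuc x m → ∀ {i j} → i < j → j ≤ m → x ^ i ≢ x ^ j
  ^-injective-below-order (_ , below) {j = suc k} z<s k<m ε≡x^j = below k<m (sym ε≡x^j)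
  ^-injective-below-order {x} x-order {suc i} {suc j} (s<s i<j) 1+j≤m x^i≡x^j =
    ^-injective-below-order x-order {i} {j} i<j (<⇒≤ 1+j≤m) (∙-cancelˡ x _ _ x^i≡x^j)

  LeftClosed : Elt G → Subset order → Set
  LeftClosed x T = ∀ {t} → t ∈ T → x ∙ t ∈ T

  module Orbit {x m} (x-order : HasOrderSuc x m) (s : Elt G) where

    orbit : ℕ → Subset order
    orbit zero    = ⊥
    orbit (suc i) = orbit i ∪ ⁅ x ^ i ∙ s ⁆

    ∈-orbit⁻ : ∀ i {t} → t ∈ orbit i → ∃ λ j → j < i × x ^ j ∙ s ≡ t
    ∈-orbit⁻ zero    t∈⊥ = contradiction t∈⊥ ∉⊥
    ∈-orbit⁻ (suc i) t∈orbit with x∈p∪q⁻ (orbit i) _ t∈orbit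
    ... | inj₁ t∈orbit-i = let j , j<i , eq = ∈-orbit⁻ i t∈orbit-i in j , m<n⇒m<1+n j<i , eq
    ... | inj₂ t∈⁅x^i∙s⁆ = i , n<1+n i , sym (x∈⁅y⁆⇒x≡y _ t∈⁅x^i∙s⁆)

    ∈-orbit⁺ : ∀ {i j} → j < i → x ^ j ∙ s ∈ orbit i
    ∈-orbit⁺ {suc i} j<1+i with m<1+n⇒m<n∨m≡n j<1+i
    ... | inj₁ j<i  = x∈p∪q⁺ (inj₁ (∈-orbit⁺ j<i))
    ... | inj₂ refl = x∈p∪q⁺ (inj₂ (x∈⁅x⁆ _))

    ∣orbit∣ : ∀ {i} → i ≤ suc m → ∣ orbit i ∣ ≡ i
    ∣orbit∣ {zero}  _       = ∣⊥∣≡0 order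
    ∣orbit∣ {suc i} 1+i≤1+m =
      trans (x∉p⇒∣p∪⁅x⁆∣≡1+∣p∣ (orbit i) new) (cong suc (∣orbit∣ (<⇒≤ 1+i≤1+m)))
      where
      new : x ^ i ∙ s ∉ orbit i
      new x^i∙s∈orbit with j , j<i , eq ← ∈-orbit⁻ i x^i∙s∈orbit =
        ^-injective-below-order x-order j<i (s≤s⁻¹ 1+i≤1+m) (∙-cancelʳ s _ _ eq)

    full-orbit : Subset order
    full-orbit = orbit (suc m)

    full-orbit⊆ : ∀ {T} → LeftClosed x T → s ∈ T → full-orbit ⊆ T
    full-orbit⊆ {T} closed s∈T t∈orbit with j , _ , refl ← ∈-orbit⁻ (suc m) t∈orbit = x^j∙s∈T j
      where
      x^j∙s∈T : ∀ j → x ^ j ∙ s ∈ T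
      x^j∙s∈T zero    = subst (_∈ T) (sym (identityˡ s)) s∈T
      x^j∙s∈T (suc j) = subst (_∈ T) (sym (assoc _ _ _)) (closed (x^j∙s∈T j))

    x∙t∈full-orbit⇒t∈full-orbit : ∀ {t} → x ∙ t ∈ full-orbit → t ∈ full-orbit
    x∙t∈full-orbit⇒t∈full-orbit {t} x∙t∈orbit with ∈-orbit⁻ (suc m) x∙t∈orbit
    ... | suc j , 1+j<1+m , eq =
      subst (_∈ full-orbit) (∙-cancelˡ x _ _ (trans (sym (assoc _ _ _)) eq))
            (∈-orbit⁺ (m<n⇒m<1+n (s<s⁻¹ 1+j<1+m)))
    ... | zero  , _       , eq = subst (_∈ full-orbit) (∙-cancelˡ x _ _ (begin
      x ∙ (x ^ m ∙ s)  ≡⟨ sym (assoc _ _ _) ⟩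
      x ^ suc m ∙ s    ≡⟨ cong (_∙ s) (proj₁ x-order) ⟩
      ε ∙ s            ≡⟨ eq ⟩
      x ∙ t            ∎)) (∈-orbit⁺ (n<1+n m))

  ^-∣leftClosed∣≡ε : ∀ {x} {T : Subset order} → LeftClosed x T → x ^ ∣ T ∣ ≡ ε
  ^-∣leftClosed∣≡ε {x} {T} = go T (<-wellFounded ∣ T ∣)
    where
    m = proj₁ (order-exists x)
    x-order = proj₂ (order-exists x)

    go : ∀ T → Acc _<_ ∣ T ∣ → LeftClosed x T → x ^ ∣ T ∣ ≡ ε
    go T (acc rec) closed with nonempty? T
    ... | no empty = cong (x ^_) (trans (cong ∣_∣ (Empty-unique empty)) (∣⊥∣≡0 order))
    ... | yes (s , s∈T) = begin
      x ^ ∣ T ∣              ≡⟨ cong (x ^_) ∣T∣≡∣R∣+1+m ⟩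
      x ^ (∣ R ∣ + suc m)    ≡⟨ ^-homo-+ x ∣ R ∣ (suc m) ⟩
      x ^ ∣ R ∣ ∙ x ^ suc m  ≡⟨ cong₂ _∙_ (go R (rec ∣R∣<∣T∣) R-closed) (proj₁ x-order) ⟩
      ε ∙ ε                  ≡⟨ identityˡ ε ⟩
      ε                      ∎
      where
      open Orbit x-order s
      R : Subset order
      R = T ∩ ∁ full-orbit

      ∣T∣≡∣R∣+1+m : ∣ T ∣ ≡ ∣ R ∣ + suc m
      ∣T∣≡∣R∣+1+m = trans (q⊆p⇒∣p∣≡∣p∩∁q∣+∣q∣ T full-orbit (full-orbit⊆ closed s∈T))
                          (cong (∣ R ∣ +_) (∣orbit∣ ≤-refl))

      ∣R∣<∣T∣ : ∣ R ∣ < ∣ T ∣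
      ∣R∣<∣T∣ = subst (∣ R ∣ <_) (sym ∣T∣≡∣R∣+1+m) (m<m+n ∣ R ∣ z<s)

      R-closed : LeftClosed x R
      R-closed t∈R with t∈T , t∉orbit ← x∈p∩q⁻ T _ t∈R =
        x∈p∩q⁺ (closed t∈T , x∉p⇒x∈∁p (x∈∁p⇒x∉p t∉orbit ∘ x∙t∈full-orbit⇒t∈full-orbit))

  module _ {H : Subset order} (H≤G : IsSubgroup G H) where
    open IsSubgroup H≤G

    ^-mem : ∀ {x} n → x ∈ H → x ^ n ∈ H
    ^-mem zero    _   = ε-mem
    ^-mem (suc n) x∈H = ∙-mem x∈H (^-mem n x∈H)

    x^b∈H⇒x∈H : ∀ {x a b} → x ^ a ≡ ε → gcd a b ≡ 1 → x ^ b ∈ H → x ∈ H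
    x^b∈H⇒x∈H {x} {a} {b} x^a≡ε gcd≡1 x^b∈H
      with Bézout.identity (subst (GCD a b) gcd≡1 (gcd-GCD a b))
    ... | Bézout.+- u v 1+vb≡ua = subst (_∈ H) (sym x≡[x^b^v]⁻¹) (⁻¹-mem (^-mem v x^b∈H))
      where
      x≡[x^b^v]⁻¹ : x ≡ ((x ^ b) ^ v) ⁻¹
      x≡[x^b^v]⁻¹ = inverseˡ-unique x _ (begin
        x ∙ (x ^ b) ^ v  ≡⟨ cong (x ∙_) (^-assoc x v b) ⟩
        x ^ suc (v * b)  ≡⟨ cong (x ^_) 1+vb≡ua ⟩
        x ^ (u * a)      ≡⟨ x^a≡ε⇒x^[k*a]≡ε x^a≡ε u ⟩
        ε                ∎)
    ... | Bézout.-+ u v 1+ua≡vb = subst (_∈ H) x^b^v≡x (^-mem v x^b∈H)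
      where
      x^b^v≡x : (x ^ b) ^ v ≡ x
      x^b^v≡x = begin
        (x ^ b) ^ v      ≡⟨ ^-assoc x v b ⟩
        x ^ (v * b)      ≡⟨ cong (x ^_) (sym 1+ua≡vb) ⟩
        x ∙ x ^ (u * a)  ≡⟨ cong (x ∙_) (x^a≡ε⇒x^[k*a]≡ε x^a≡ε u) ⟩
        x ∙ ε            ≡⟨ identityʳ x ⟩
        x                ∎

    x∙y∈H⇒x∈H : ∀ {x y a b} → x ^ a ≡ ε → y ^ b ≡ ε → gcd a b ≡ 1 →
                x ∙ y ≡ y ∙ x → x ∙ y ∈ H → x ∈ H
    x∙y∈H⇒x∈H {x} {y} {a} {b} x^a≡ε y^b≡ε gcd≡1 x∙y≡y∙x x∙y∈H =
      x^b∈H⇒x∈H {x} {a} {b} x^a≡ε gcd≡1 (subst (_∈ H) [x∙y]^b≡x^b (^-mem b x∙y∈H))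
      where
      [x∙y]^b≡x^b : (x ∙ y) ^ b ≡ x ^ b
      [x∙y]^b≡x^b = begin
        (x ∙ y) ^ b      ≡⟨ ^-distrib-∙ x∙y≡y∙x b ⟩
        x ^ b ∙ y ^ b    ≡⟨ cong (x ^ b ∙_) y^b≡ε ⟩
        x ^ b ∙ ε        ≡⟨ identityʳ _ ⟩
        x ^ b            ∎

module KernelProperties (G₁ G₂ : FinGroup) (π : Elt G₁ → Elt G₂) (hom : IsHom G₁ G₂ π) where
  open FinGroup G₁ using (_∙_; _⁻¹)
  open FinGroup G₂ using () renaming (_∙_ to _∙₂_; _⁻¹ to _⁻¹₂; ε to ε₂)
  open IsGroup (FinGroup.isGroup G₂) using () renaming (identityˡ to identityˡ₂; inverseˡ to inverseˡ₂)
  open GroupMorphisms.IsGroupHomomorphism hom using (homo; ⁻¹-homo)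
  open FinGroupProperties G₁ using (LeftClosed)
  open ≡-Reasoning

  ∈-ker⁺ : ∀ {x} → π x ≡ ε₂ → x ∈ ker G₁ G₂ π
  ∈-ker⁺ {x} πx≡ε = lookup⇒[]= x _ (trans (lookup∘tabulate _ x) (dec-true (π x ≟ ε₂) πx≡ε))

  ∈-ker⁻ : ∀ {x} → x ∈ ker G₁ G₂ π → π x ≡ ε₂
  ∈-ker⁻ {x} x∈ker = invert (subst (Reflects _) does≡true (proof (π x ≟ ε₂)))
    where
    does≡true = trans (sym (lookup∘tabulate _ x)) ([]=⇒lookup x∈ker)

  ker-leftClosed : ∀ {k} → k ∈ ker G₁ G₂ π → LeftClosed k (ker G₁ G₂ π)
  ker-leftClosed {k} k∈ker {t} t∈ker = ∈-ker⁺ (begin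
    π (k ∙ t)    ≡⟨ homo k t ⟩
    π k ∙₂ π t   ≡⟨ cong₂ _∙₂_ (∈-ker⁻ k∈ker) (∈-ker⁻ t∈ker) ⟩
    ε₂ ∙₂ ε₂     ≡⟨ identityˡ₂ ε₂ ⟩
    ε₂           ∎)

  πx≡πy⇒x⁻¹∙y∈ker : ∀ {x y} → π x ≡ π y → x ⁻¹ ∙ y ∈ ker G₁ G₂ π
  πx≡πy⇒x⁻¹∙y∈ker {x} {y} πx≡πy = ∈-ker⁺ (begin
    π (x ⁻¹ ∙ y)     ≡⟨ homo (x ⁻¹) y ⟩
    π (x ⁻¹) ∙₂ π y  ≡⟨ cong₂ _∙₂_ (⁻¹-homo x) (sym πx≡πy) ⟩
    π x ⁻¹₂ ∙₂ π x   ≡⟨ inverseˡ₂ (π x) ⟩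
    ε₂               ∎)

lemma3p7 : (G₁ G₂ : FinGroup) (π : Elt G₁ → Elt G₂) →
    IsHom G₁ G₂ π → Surjective π →
    (H₁ : Subset (FinGroup.order G₁)) (H₂ : Subset (FinGroup.order G₂)) →
    IsSubgroup G₁ H₁ → IsSubgroup G₂ H₂ → ImageIs G₁ G₂ π H₁ H₂ →
    (N₁ : Subset (FinGroup.order G₁)) (N₂ : Subset (FinGroup.order G₂)) →
    IsNormalSubgroup G₁ N₁ → IsNormalSubgroup G₂ N₂ → ImageIs G₁ G₂ π N₁ N₂ →
    gcd ∣ N₁ ∣ ∣ ker G₁ G₂ π ∣ ≡ 1 →
    (∀ x k → x ∈ N₁ → k ∈ ker G₁ G₂ π → FinGroup.[_,_] G₁ x k ≡ FinGroup.ε G₁) →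
    (N₁ ⊆ H₁ → N₂ ⊆ H₂) × (N₂ ⊆ H₂ → N₁ ⊆ H₁)
lemma3p7 G₁ G₂ π hom _ H₁ H₂ H₁≤G₁ _ (πH₁⊆H₂ , H₂⊆πH₁) N₁ N₂ N₁⊴G₁ _ (πN₁⊆N₂ , N₂⊆πN₁)
         gcd≡1 [N₁,ker]≡ε = N₁⊆H₁⇒N₂⊆H₂ , N₂⊆H₂⇒N₁⊆H₁
  where
  open FinGroup G₁ using (_∙_; _⁻¹)
  open FinGroupProperties G₁
  open GroupProperties group using (\\-leftDividesˡ)
  open KernelProperties G₁ G₂ π hom
  open IsSubgroup (IsNormalSubgroup.isSubgroup N₁⊴G₁) using (∙-mem)
  K = ker G₁ G₂ π

  N₁⊆H₁⇒N₂⊆H₂ : N₁ ⊆ H₁ → N₂ ⊆ H₂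
  N₁⊆H₁⇒N₂⊆H₂ N₁⊆H₁ y∈N₂ with x , x∈N₁ , refl ← N₂⊆πN₁ _ y∈N₂ = πH₁⊆H₂ x (N₁⊆H₁ x∈N₁)

  N₂⊆H₂⇒N₁⊆H₁ : N₂ ⊆ H₂ → N₁ ⊆ H₁
  N₂⊆H₂⇒N₁⊆H₁ N₂⊆H₂ {n} n∈N₁ with h , h∈H₁ , πh≡πn ← H₂⊆πH₁ _ (N₂⊆H₂ (πN₁⊆N₂ n n∈N₁)) =
    x∙y∈H⇒x∈H H₁≤G₁ {n} {k} {∣ N₁ ∣} {∣ K ∣}
      (^-∣leftClosed∣≡ε {n} {N₁} (∙-mem n∈N₁))
      (^-∣leftClosed∣≡ε {k} {K} (ker-leftClosed k∈K))
      gcd≡1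
      ([x,y]≡ε⇒x∙y≡y∙x ([N₁,ker]≡ε n k n∈N₁ k∈K))
      (subst (_∈ H₁) (sym (\\-leftDividesˡ n h)) h∈H₁)
    where
    k = n ⁻¹ ∙ h
    k∈K = πx≡πy⇒x⁻¹∙y∈ker (sym πh≡πn)
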